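{- The following two families of ternary relations are uniformly existential on $\mathbf M$: (1) $R_0=\langle R_0^{(d)}\mid d\in\omega\rangle$, where $R_0^{(d)}(a,b,t)$ holds for $a,b,t\in\mathbf M_d$ iff $t\le d$ and $a[k,t]\neq b[k,t]$ for all $k<2^{d-t}$; (2) $R_1=\langle R_1^{(d)}\mid d\in\omega\rangle$, where $R_1^{(d)}(a,b,t)$ holds iff $t\le d$ and $a[k,t]\le b[k,t]$ for all $k<2^{d-t}$.
   Context: $\mathcal M$ is the first-order language with equality with constants $\mathbf 0,\mathbf 1,-\mathbf 1,\mathbf n$, unary $\mathcal N,\mathbf p$, binary $+,\times,\div,\max,\min,\cap$; $\mathbf M_d$ ($n=2^d$) has universe $\{0,\dots,2^n-1\}$ with $+,\times$ mod $2^n$, $\mathbf p(x)=\min\{2^x,2^n-1\}$, $\div(x,y)=\lfloor x/y\rfloor$ ($0$ for $y=0$), constants $0,1,n,2^n-1$, usual $\max,\min$, bitwise AND $\cap$ and bitwise complement $\mathcal N$. $a[i,t]$ is the $i$-th digit of $a$ in base $2^{2^t}$. A family $\langle R^{(d)}\mid d\in\omega\rangle$ of $k$-ary relations, $R^{(d)}$ on $\mathbf M_d$, is uniformly existential on $\mathbf M$ if there is a single existential first-order formula $\phi(x_0,\dots,x_{k-1})$ of $\mathcal M$ such that for all $d$ and all $a_0,\dots,a_{k-1}\in\mathbf M_d$: $R^{(d)}(a_0,\dots,a_{k-1})$ iff $\mathbf M_d\models\phi(a_0,\dots,a_{k-1})$. -}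

module Defs where

open import Data.Nat using (ℕ; zero; suc; _+_; _*_; _∸_; _^_; _≤_; _<_; _⊔_; _⊓_; _≡ᵇ_)
open import Data.Nat.DivMod using (_/_; _%_)
open import Data.Fin using (Fin)
open import Data.Product using (Σ; _×_; _,_)
open import Data.Sum using (_⊎_)
open import Data.Empty using (⊥)
open import Data.Bool using (if_then_else_)
open import Relation.Binary.PropositionalEquality using (_≡_; _≢_)
open import Relation.Nullary using (¬_)
open import Function.Bundles using (_⇔_)
open import Data.Vec.Functional using (Vector; _++_; [])
  renaming (_∷_ to _∷ᵛ_)

nOf : ℕ → ℕ
nOf d = 2 ^ d

size : ℕ → ℕ
size d = 2 ^ nOf d

modT : ℕ → ℕ → ℕ
modT x zero = x
modT x (suc y) = x % suc y

divT : ℕ → ℕ → ℕ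
divT x zero = 0
divT x (suc y) = x / suc y

-- bitwise AND of the lowest `fuel` bits
andBits : ℕ → ℕ → ℕ → ℕ
andBits zero x y = 0
andBits (suc f) x y = (x % 2) * (y % 2) + 2 * andBits f (x / 2) (y / 2)

addM mulM divM maxM minM capM : ℕ → ℕ → ℕ → ℕ
addM d x y = modT (x + y) (size d)
mulM d x y = modT (x * y) (size d)
divM d x y = divT x y
maxM d x y = x ⊔ y
minM d x y = x ⊓ y
capM d x y = andBits (nOf d) x y

-- bitwise complement within n bits: (2^n - 1) - x
negM : ℕ → ℕ → ℕ
negM d x = (size d ∸ 1) ∸ x

pM : ℕ → ℕ → ℕ
pM d x = (2 ^ x) ⊓ (size d ∸ 1)

data Term (v : ℕ) : Set where
  var  : Fin v → Term v
  c0 c1 cm1 cn : Term v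
  ⟨N⟩ ⟨p⟩ : Term v → Term v
  ⟨+⟩ ⟨×⟩ ⟨÷⟩ ⟨max⟩ ⟨min⟩ ⟨∩⟩ : Term v → Term v → Term v

data QF (v : ℕ) : Set where
  _≐_  : Term v → Term v → QF v
  ¬ᶠ_  : QF v → QF v
  _∧ᶠ_ _∨ᶠ_ : QF v → QF v → QF v

-- existential formulas with k free variables (x_0..x_{k-1}):
-- ∃ y_0 … ∃ y_{m-1} ψ with ψ quantifier-free in x_0..x_{k-1},y_0..y_{m-1}
record ExFormula (k : ℕ) : Set where
  constructor ∃ᶠ
  field
    nbound : ℕ
    matrix : QF (k + nbound)

evalT : ∀ {v} → ℕ → Vector ℕ v → Term v → ℕ
evalT d ρ (var i) = ρ i
evalT d ρ c0 = 0
evalT d ρ c1 = 1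
evalT d ρ cm1 = size d ∸ 1
evalT d ρ cn = nOf d
evalT d ρ (⟨N⟩ s) = negM d (evalT d ρ s)
evalT d ρ (⟨p⟩ s) = pM d (evalT d ρ s)
evalT d ρ (⟨+⟩ s u) = addM d (evalT d ρ s) (evalT d ρ u)
evalT d ρ (⟨×⟩ s u) = mulM d (evalT d ρ s) (evalT d ρ u)
evalT d ρ (⟨÷⟩ s u) = divM d (evalT d ρ s) (evalT d ρ u)
evalT d ρ (⟨max⟩ s u) = maxM d (evalT d ρ s) (evalT d ρ u)
evalT d ρ (⟨min⟩ s u) = minM d (evalT d ρ s) (evalT d ρ u)
evalT d ρ (⟨∩⟩ s u) = capM d (evalT d ρ s) (evalT d ρ u)

SatQF : ∀ {v} → ℕ → Vector ℕ v → QF v → Set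
SatQF d ρ (s ≐ u) = evalT d ρ s ≡ evalT d ρ u
SatQF d ρ (¬ᶠ φ) = ¬ SatQF d ρ φ
SatQF d ρ (φ ∧ᶠ ψ) = SatQF d ρ φ × SatQF d ρ ψ
SatQF d ρ (φ ∨ᶠ ψ) = SatQF d ρ φ ⊎ SatQF d ρ ψ

Sat : ∀ {k} → ℕ → ExFormula k → Vector ℕ k → Set
Sat d (∃ᶠ m ψ) a =
  Σ (Vector ℕ m) λ w → ((i : Fin m) → w i < size d) × SatQF d (a ++ w) ψ

Family : ℕ → Set₁
Family k = ℕ → Vector ℕ k → Set

UniformlyExistential : ∀ {k} → Family k → Set
UniformlyExistential {k} R =
  Σ (ExFormula k) λ φ → ∀ (d : ℕ) (a : Vector ℕ k) →
    ((i : Fin k) → a i < size d) → (R d a ⇔ Sat d φ a)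

-- digits: a[i,t] = i-th digit of a in base 2^(2^t)

digit : ℕ → ℕ → ℕ → ℕ
digit a i t = modT (divT a (2 ^ (2 ^ t * i))) (2 ^ (2 ^ t))

vec3 : ℕ → ℕ → ℕ → Vector ℕ 3
vec3 a b t = a ∷ᵛ (b ∷ᵛ (t ∷ᵛ []))

R0rel : ℕ → ℕ → ℕ → ℕ → Set
R0rel d a b t = t ≤ d × (∀ k → k < 2 ^ (d ∸ t) → digit a k t ≢ digit b k t)

R1rel : ℕ → ℕ → ℕ → ℕ → Set
R1rel d a b t = t ≤ d × (∀ k → k < 2 ^ (d ∸ t) → digit a k t ≤ digit b k t)

R0 : Family 3
R0 d v = R0rel d (v Fin.zero) (v (Fin.suc Fin.zero)) (v (Fin.suc (Fin.suc Fin.zero)))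
  where import Data.Fin as Fin

R1 : Family 3
R1 d v = R1rel d (v Fin.zero) (v (Fin.suc Fin.zero)) (v (Fin.suc (Fin.suc Fin.zero)))
  where import Data.Fin as Fin

module Submission where

-- Both relations are defined by quantifier-free formulas. For t = d the only digit is the
-- number itself, so the relations are a ≠ b and a ≤ b. For t < d let T = 2^t be the digit
-- width and B = 2^T the base, and view a number as blocks of width 2T, each holding two
-- digits. The constants Q = (2^n − 1)/(B² − 1) = Σ_j B^(2j) and F = B·Q are definable. If
-- u and v carry digits u_j, v_j < B in the low half of each block, then block j of
-- v + F − u is B + v_j − u_j, whose bit of weight B is set iff u_j ≤ v_j; hence u ≤ v
-- digitwise iff (v + F − u) ∩ F = F. Masking with (B − 1)·Q and B(B − 1)·Q brings the even
-- and the odd digits of a and b into this form. For R₀, the bitwise xor a + b − 2(a ∩ b)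
-- has every digit nonzero iff a and b differ in every digit, which is a digitwise
-- comparison with the number Q + F whose digits are all 1.

open import Defs
open import Data.Nat
open import Data.Nat.Properties
open import Data.Nat.DivMod
open import Data.Nat.Divisibility using (divides; divides-refl)
open import Data.Nat.Tactic.RingSolver using (solve-∀)
open import Data.Product using (∃-syntax; _×_; _,_; proj₁; proj₂)
open import Data.Sum using (_⊎_; inj₁; inj₂)
open import Data.Empty using (⊥-elim)
open import Function.Bundles using (_⇔_; mk⇔; Equivalence)
import Function.Properties.Equivalence as ⇔
open import Relation.Binary.PropositionalEquality
open import Relation.Nullary using (¬_; yes; no)
import Data.Fin as F
open import Data.Vec.Functional using (Vector; _++_)

≡⇒⇔ : ∀ {A B : Set} → A ≡ B → A ⇔ B
≡⇒⇔ refl = ⇔.refl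

2^≢0 : ∀ k → NonZero (2 ^ k)
2^≢0 k = m^n≢0 2 k

infixl 7 _%2^_ _/2^_
_%2^_ _/2^_ : ℕ → ℕ → ℕ
x %2^ k = _%_ x (2 ^ k) {{2^≢0 k}}
x /2^ k = _/_ x (2 ^ k) {{2^≢0 k}}

[m+kn]/n≡m/n+k : ∀ m k n .{{_ : NonZero n}} → (m + k * n) / n ≡ m / n + k
[m+kn]/n≡m/n+k m k n = trans (+-distrib-/-∣ʳ m (divides-refl k)) (cong (m / n +_) (m*n/n≡m k n))

m<n⇒[m+kn]%n≡m : ∀ {m} k n .{{_ : NonZero n}} → m < n → (m + k * n) % n ≡ m
m<n⇒[m+kn]%n≡m {m} k n m<n = trans ([m+kn]%n≡m%n m k n) (m<n⇒m%n≡m m<n)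

m<n⇒[m+kn]/n≡k : ∀ {m} k n .{{_ : NonZero n}} → m < n → (m + k * n) / n ≡ k
m<n⇒[m+kn]/n≡k {m} k n m<n = trans ([m+kn]/n≡m/n+k m k n) (cong (_+ k) (m<n⇒m/n≡0 m<n))

m%n+n*[m/n]≡m : ∀ m n .{{_ : NonZero n}} → m % n + n * (m / n) ≡ m
m%n+n*[m/n]≡m m n = trans (cong (m % n +_) (*-comm n (m / n))) (sym (m≡m%n+[m/n]*n m n))

modT≡% : ∀ x N .{{_ : NonZero N}} → modT x N ≡ x % N
modT≡% x (suc N) = refl

divT≡/ : ∀ x N .{{_ : NonZero N}} → divT x N ≡ x / N
divT≡/ x (suc N) = refl

[m%n+o]%n≡[m+o]%n : ∀ m o n .{{_ : NonZero n}} → (m % n + o) % n ≡ (m + o) % n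
[m%n+o]%n≡[m+o]%n m o n = begin
    (m % n + o) % n        ≡⟨ %-distribˡ-+ (m % n) o n ⟩
    (m % n % n + o % n) % n ≡⟨ cong (λ z → (z + o % n) % n) (m%n%n≡m%n m n) ⟩
    (m % n + o % n) % n     ≡⟨ %-distribˡ-+ m o n ⟨
    (m + o) % n             ∎
  where open ≡-Reasoning

m%2≤1 : ∀ m → m % 2 ≤ 1
m%2≤1 m = ≤-pred (m%n<n m 2)

b+2m<2^[1+f] : ∀ {b m f} → b ≤ 1 → m < 2 ^ f → b + 2 * m < 2 ^ suc f
b+2m<2^[1+f] {b} {m} {f} b≤1 m<2^f = begin
    suc (b + 2 * m) ≤⟨ s≤s (+-monoˡ-≤ (2 * m) b≤1) ⟩
    2 + 2 * m       ≡⟨ *-suc 2 m ⟨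
    2 * suc m       ≤⟨ *-monoʳ-≤ 2 m<2^f ⟩
    2 ^ suc f       ∎
  where open ≤-Reasoning

%2^-suc : ∀ x f → x %2^ suc f ≡ x % 2 + 2 * (x / 2 %2^ f)
%2^-suc x f = begin
    x %2^ suc f                                ≡⟨ cong (_%2^ suc f) x≡ ⟨
    (x % 2 + 2 * (x / 2 %2^ f) + q * 2 ^ suc f) %2^ suc f
      ≡⟨ m<n⇒[m+kn]%n≡m q (2 ^ suc f) {{2^≢0 (suc f)}} (b+2m<2^[1+f] {f = f} (m%2≤1 x) (m%n<n (x / 2) (2 ^ f) {{2^≢0 f}})) ⟩
    x % 2 + 2 * (x / 2 %2^ f)                  ∎
  where
  open ≡-Reasoning
  q = x / 2 /2^ f
  regroup : ∀ a b c P → a + 2 * b + c * (2 * P) ≡ a + 2 * (b + P * c)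
  regroup = solve-∀
  x≡ : x % 2 + 2 * (x / 2 %2^ f) + q * 2 ^ suc f ≡ x
  x≡ = begin
    x % 2 + 2 * (x / 2 %2^ f) + q * (2 * 2 ^ f) ≡⟨ regroup (x % 2) (x / 2 %2^ f) q (2 ^ f) ⟩
    x % 2 + 2 * (x / 2 %2^ f + 2 ^ f * q)      ≡⟨ cong (λ z → x % 2 + 2 * z) (m%n+n*[m/n]≡m (x / 2) (2 ^ f) {{2^≢0 f}}) ⟩
    x % 2 + 2 * (x / 2)                        ≡⟨ m%n+n*[m/n]≡m x 2 ⟩
    x                                          ∎

andBits-comm : ∀ f x y → andBits f x y ≡ andBits f y x
andBits-comm zero x y = refl
andBits-comm (suc f) x y =
  cong₂ (λ b r → b + 2 * r) (*-comm (x % 2) (y % 2)) (andBits-comm f (x / 2) (y / 2))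

andBits-zeroʳ : ∀ f x → andBits f x 0 ≡ 0
andBits-zeroʳ zero x = refl
andBits-zeroʳ (suc f) x rewrite andBits-zeroʳ f (x / 2) | *-zeroʳ (x % 2) = refl

andBits-one : ∀ f x → andBits (suc f) x 1 ≡ x % 2
andBits-one f x rewrite andBits-zeroʳ f (x / 2) | *-identityʳ (x % 2) = +-identityʳ _

andBits-ignores-highˡ : ∀ f x r y → andBits f (x + 2 ^ f * r) y ≡ andBits f x y
andBits-ignores-highˡ zero x r y = refl
andBits-ignores-highˡ (suc f) x r y =
  cong₂ (λ b z → b * (y % 2) + 2 * z) low-bit
    (trans (cong (λ z → andBits f z (y / 2)) rest) (andBits-ignores-highˡ f (x / 2) r (y / 2)))
  where
  2^[1+f]r≡ : 2 ^ suc f * r ≡ 2 ^ f * r * 2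
  2^[1+f]r≡ = trans (*-assoc 2 (2 ^ f) r) (*-comm 2 (2 ^ f * r))
  low-bit : (x + 2 ^ suc f * r) % 2 ≡ x % 2
  low-bit = trans (cong (λ z → (x + z) % 2) 2^[1+f]r≡) ([m+kn]%n≡m%n x (2 ^ f * r) 2)
  rest : (x + 2 ^ suc f * r) / 2 ≡ x / 2 + 2 ^ f * r
  rest = trans (cong (λ z → (x + z) / 2) 2^[1+f]r≡) ([m+kn]/n≡m/n+k x (2 ^ f * r) 2)

andBits-ignores-highʳ : ∀ f x y r → andBits f x (y + 2 ^ f * r) ≡ andBits f x y
andBits-ignores-highʳ f x y r =
  trans (andBits-comm f x _) (trans (andBits-ignores-highˡ f y r x) (andBits-comm f y x))

andBits-%2^ˡ : ∀ f x y → andBits f x y ≡ andBits f (x %2^ f) y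
andBits-%2^ˡ f x y =
  trans (cong (λ z → andBits f z y) (sym (m%n+n*[m/n]≡m x (2 ^ f) {{2^≢0 f}})))
        (andBits-ignores-highˡ f (x %2^ f) (x /2^ f) y)

andBits-%2^ : ∀ f x y → andBits f x y ≡ andBits f (x %2^ f) (y %2^ f)
andBits-%2^ f x y = begin
  andBits f x y                  ≡⟨ andBits-%2^ˡ f x y ⟩
  andBits f (x %2^ f) y          ≡⟨ andBits-comm f _ y ⟩
  andBits f y (x %2^ f)          ≡⟨ andBits-%2^ˡ f y _ ⟩
  andBits f (y %2^ f) (x %2^ f)  ≡⟨ andBits-comm f _ _ ⟩
  andBits f (x %2^ f) (y %2^ f)  ∎
  where open ≡-Reasoning

andBits-+ : ∀ f g x y → andBits (f + g) x y ≡ andBits f x y + 2 ^ f * andBits g (x /2^ f) (y /2^ f)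
andBits-+ zero g x y rewrite n/1≡n x | n/1≡n y = sym (+-identityʳ _)
andBits-+ (suc f) g x y = begin
    b + 2 * andBits (f + g) (x / 2) (y / 2)
  ≡⟨ cong (λ z → b + 2 * z) (andBits-+ f g (x / 2) (y / 2)) ⟩
    b + 2 * (andBits f (x / 2) (y / 2) + 2 ^ f * andBits g (x / 2 /2^ f) (y / 2 /2^ f))
  ≡⟨ cong₂ (λ u v → b + 2 * (andBits f (x / 2) (y / 2) + 2 ^ f * andBits g u v)) (/2/2^ x) (/2/2^ y) ⟩
    b + 2 * (andBits f (x / 2) (y / 2) + 2 ^ f * andBits g (x /2^ suc f) (y /2^ suc f))
  ≡⟨ regroup b (andBits f (x / 2) (y / 2)) (2 ^ f) (andBits g (x /2^ suc f) (y /2^ suc f)) ⟩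
    b + 2 * andBits f (x / 2) (y / 2) + 2 ^ suc f * andBits g (x /2^ suc f) (y /2^ suc f)
  ∎
  where
  open ≡-Reasoning
  b = x % 2 * (y % 2)
  /2/2^ : ∀ z → z / 2 /2^ f ≡ z /2^ suc f
  /2/2^ z = m/n/o≡m/[n*o] z 2 (2 ^ f) {{_}} {{2^≢0 f}} {{2^≢0 (suc f)}}
  regroup : ∀ a b P c → a + 2 * (b + P * c) ≡ a + 2 * b + 2 * P * c
  regroup = solve-∀

andBits-ones : ∀ f x → andBits f x (2 ^ f ∸ 1) ≡ x %2^ f
andBits-ones zero x = sym (n%1≡0 x)
andBits-ones (suc f) x = begin
    x % 2 * ((2 ^ suc f ∸ 1) % 2) + 2 * andBits f (x / 2) ((2 ^ suc f ∸ 1) / 2)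
  ≡⟨ cong₂ (λ u v → x % 2 * u + 2 * andBits f (x / 2) v) low-bit rest ⟩
    x % 2 * 1 + 2 * andBits f (x / 2) (2 ^ f ∸ 1)
  ≡⟨ cong₂ (λ u v → u + 2 * v) (*-identityʳ (x % 2)) (andBits-ones f (x / 2)) ⟩
    x % 2 + 2 * (x / 2 %2^ f)
  ≡⟨ %2^-suc x f ⟨
    x %2^ suc f
  ∎
  where
  open ≡-Reasoning
  ones≡ : 2 ^ suc f ∸ 1 ≡ 1 + (2 ^ f ∸ 1) * 2
  ones≡ with 2 ^ f | m^n>0 2 f
  ... | suc p | _ = solve-p p
    where solve-p : ∀ p → p + suc (p + 0) ≡ 1 + p * 2
          solve-p = solve-∀
  low-bit : (2 ^ suc f ∸ 1) % 2 ≡ 1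
  low-bit = trans (cong (_% 2) ones≡) (m<n⇒[m+kn]%n≡m (2 ^ f ∸ 1) 2 (s≤s (s≤s z≤n)))
  rest : (2 ^ suc f ∸ 1) / 2 ≡ 2 ^ f ∸ 1
  rest = trans (cong (_/ 2) ones≡) (m<n⇒[m+kn]/n≡k (2 ^ f ∸ 1) 2 (s≤s (s≤s z≤n)))

b≤1⇒b*b≡b : ∀ {b} → b ≤ 1 → b * b ≡ b
b≤1⇒b*b≡b z≤n = refl
b≤1⇒b*b≡b (s≤s z≤n) = refl

andBits-idem : ∀ f x → andBits f x x ≡ x %2^ f
andBits-idem zero x = sym (n%1≡0 x)
andBits-idem (suc f) x =
  trans (cong₂ (λ b r → b + 2 * r) (b≤1⇒b*b≡b (m%2≤1 x)) (andBits-idem f (x / 2))) (sym (%2^-suc x f))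

andBits≤ˡ : ∀ f x y → andBits f x y ≤ x
andBits≤ˡ zero x y = z≤n
andBits≤ˡ (suc f) x y = begin
    x % 2 * (y % 2) + 2 * andBits f (x / 2) (y / 2)
  ≤⟨ +-mono-≤ (≤-trans (*-monoʳ-≤ (x % 2) (m%2≤1 y)) (≤-reflexive (*-identityʳ (x % 2))))
              (*-monoʳ-≤ 2 (andBits≤ˡ f (x / 2) (y / 2))) ⟩
    x % 2 + 2 * (x / 2)
  ≡⟨ m%n+n*[m/n]≡m x 2 ⟩
    x
  ∎
  where open ≤-Reasoning

bit-sum : ∀ {a b} → a ≤ 1 → b ≤ 1 → ∃[ e ] e ≤ 1 × a + b ≡ e + 2 * (a * b)
bit-sum z≤n z≤n = 0 , z≤n , refl
bit-sum z≤n (s≤s z≤n) = 1 , s≤s z≤n , refl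
bit-sum (s≤s z≤n) z≤n = 1 , s≤s z≤n , refl
bit-sum (s≤s z≤n) (s≤s z≤n) = 0 , z≤n , refl

-- The witness is the bitwise xor of the low f bits.
∃xor : ∀ f x y → ∃[ X ] X < 2 ^ f × x %2^ f + y %2^ f ≡ X + 2 * andBits f x y
∃xor zero x y = 0 , s≤s z≤n , cong₂ _+_ (n%1≡0 x) (n%1≡0 y)
∃xor (suc f) x y with ∃xor f (x / 2) (y / 2) | bit-sum (m%2≤1 x) (m%2≤1 y)
... | X , X< , sum≡ | e , e≤1 , bits≡ = e + 2 * X , b+2m<2^[1+f] {f = f} e≤1 X< , (begin
    x %2^ suc f + y %2^ suc f
  ≡⟨ cong₂ _+_ (%2^-suc x f) (%2^-suc y f) ⟩
    x % 2 + 2 * (x / 2 %2^ f) + (y % 2 + 2 * (y / 2 %2^ f))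
  ≡⟨ regroup₁ (x % 2) (y % 2) (x / 2 %2^ f) (y / 2 %2^ f) ⟩
    (x % 2 + y % 2) + 2 * (x / 2 %2^ f + y / 2 %2^ f)
  ≡⟨ cong₂ (λ u v → u + 2 * v) bits≡ sum≡ ⟩
    (e + 2 * (x % 2 * (y % 2))) + 2 * (X + 2 * andBits f (x / 2) (y / 2))
  ≡⟨ regroup₂ e (x % 2 * (y % 2)) X (andBits f (x / 2) (y / 2)) ⟩
    e + 2 * X + 2 * (x % 2 * (y % 2) + 2 * andBits f (x / 2) (y / 2))
  ∎)
  where
  open ≡-Reasoning
  regroup₁ : ∀ a b c d → a + 2 * c + (b + 2 * d) ≡ (a + b) + 2 * (c + d)
  regroup₁ = solve-∀
  regroup₂ : ∀ e p X A → (e + 2 * p) + 2 * (X + 2 * A) ≡ e + 2 * X + 2 * (p + 2 * A)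
  regroup₂ = solve-∀

xor≡0⇔≡ : ∀ f {x y X} → x < 2 ^ f → y < 2 ^ f → x + y ≡ X + 2 * andBits f x y → X ≡ 0 ⇔ x ≡ y
xor≡0⇔≡ f {x} {y} {X} x< y< sum≡ = mk⇔ X≡0⇒x≡y x≡y⇒X≡0
  where
  α = andBits f x y
  α≤x : α ≤ x
  α≤x = andBits≤ˡ f x y
  α≤y : α ≤ y
  α≤y = subst (_≤ y) (andBits-comm f y x) (andBits≤ˡ f y x)
  X≡0⇒x≡y : X ≡ 0 → x ≡ y
  X≡0⇒x≡y refl = trans (≤-antisym x≤α α≤x) (≤-antisym α≤y y≤α)
    where
    x+y≡α+α : x + y ≡ α + α
    x+y≡α+α = trans sum≡ (cong (α +_) (+-identityʳ α))
    x≤α : x ≤ α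
    x≤α = +-cancelʳ-≤ y x α (≤-trans (≤-reflexive x+y≡α+α) (+-monoʳ-≤ α α≤y))
    y≤α : y ≤ α
    y≤α = +-cancelˡ-≤ x y α (≤-trans (≤-reflexive x+y≡α+α) (+-monoˡ-≤ α α≤x))
  x≡y⇒X≡0 : x ≡ y → X ≡ 0
  x≡y⇒X≡0 refl = +-cancelʳ-≡ (2 * x) X 0 (sym (begin
      0 + 2 * x  ≡⟨ cong (x +_) (+-identityʳ x) ⟩
      x + x      ≡⟨ sum≡ ⟩
      X + 2 * α  ≡⟨ cong (λ z → X + 2 * z) (trans (andBits-idem f x) (m<n⇒m%n≡m {{2^≢0 f}} x<)) ⟩
      X + 2 * x  ∎))
    where open ≡-Reasoning

fromDigits : ℕ → ℕ → (ℕ → ℕ) → ℕ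
fromDigits C zero f = 0
fromDigits C (suc L) f = f 0 + C * fromDigits C L (λ j → f (suc j))

repunit : ℕ → ℕ → ℕ
repunit C L = fromDigits C L (λ _ → 1)

fromDigits-+ : ∀ C L f g → fromDigits C L (λ j → f j + g j) ≡ fromDigits C L f + fromDigits C L g
fromDigits-+ C zero f g = refl
fromDigits-+ C (suc L) f g
  rewrite fromDigits-+ C L (λ j → f (suc j)) (λ j → g (suc j)) = regroup (f 0) (g 0) C _ _
  where regroup : ∀ a b C u v → a + b + C * (u + v) ≡ a + C * u + (b + C * v)
        regroup = solve-∀

fromDigits-* : ∀ C L k f → fromDigits C L (λ j → k * f j) ≡ k * fromDigits C L f
fromDigits-* C zero k f = sym (*-zeroʳ k)
fromDigits-* C (suc L) k f
  rewrite fromDigits-* C L k (λ j → f (suc j)) = regroup k (f 0) C _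
  where regroup : ∀ k a C u → k * a + C * (k * u) ≡ k * (a + C * u)
        regroup = solve-∀

fromDigits-cong : ∀ C L {f g} → (∀ j → j < L → f j ≡ g j) → fromDigits C L f ≡ fromDigits C L g
fromDigits-cong C zero f≗g = refl
fromDigits-cong C (suc L) f≗g =
  cong₂ (λ a b → a + C * b) (f≗g 0 (s≤s z≤n)) (fromDigits-cong C L (λ j j< → f≗g (suc j) (s≤s j<)))

fromDigits-const : ∀ C L k → fromDigits C L (λ _ → k) ≡ k * repunit C L
fromDigits-const C L k =
  trans (fromDigits-cong C L (λ _ _ → sym (*-identityʳ k))) (fromDigits-* C L k (λ _ → 1))

fromDigits< : ∀ C L f → (∀ j → j < L → f j < C) → fromDigits C L f < C ^ L
fromDigits< C zero f f< = s≤s z≤n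
fromDigits< C (suc L) f f< = begin
    suc (f 0 + C * r)  ≤⟨ +-monoˡ-≤ (C * r) (f< 0 (s≤s z≤n)) ⟩
    C + C * r          ≡⟨ *-suc C r ⟨
    C * suc r          ≤⟨ *-monoʳ-≤ C (fromDigits< C L (λ j → f (suc j)) (λ j j< → f< (suc j) (s≤s j<))) ⟩
    C * C ^ L          ∎
  where open ≤-Reasoning
        r = fromDigits C L (λ j → f (suc j))

[C∸1]*repunit+1≡C^L : ∀ c L → c * repunit (suc c) L + 1 ≡ suc c ^ L
[C∸1]*repunit+1≡C^L c zero = cong (_+ 1) (*-zeroʳ c)
[C∸1]*repunit+1≡C^L c (suc L) = begin
    c * (1 + suc c * R) + 1   ≡⟨ regroup c R ⟩
    suc c * (c * R + 1)       ≡⟨ cong (suc c *_) ([C∸1]*repunit+1≡C^L c L) ⟩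
    suc c * suc c ^ L         ∎
  where open ≡-Reasoning
        R = repunit (suc c) L
        regroup : ∀ c R → c * (1 + (1 + c) * R) + 1 ≡ (1 + c) * (c * R + 1)
        regroup = solve-∀

module _ (C : ℕ) .{{C≢0 : NonZero C}} where

  toDigits : ℕ → ℕ → ℕ
  toDigits x j = _/_ x (C ^ j) {{m^n≢0 C j}} % C

  toDigits< : ∀ x j → toDigits x j < C
  toDigits< x j = m%n<n _ C

  fromDigits-injective : ∀ L {f g} → (∀ j → j < L → f j < C) → (∀ j → j < L → g j < C) →
    fromDigits C L f ≡ fromDigits C L g → ∀ j → j < L → f j ≡ g j
  fromDigits-injective (suc L) {f} {g} f< g< eq j j< = go j j<
    where
    rf = fromDigits C L (λ j → f (suc j))
    rg = fromDigits C L (λ j → g (suc j))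
    eq′ : f 0 + rf * C ≡ g 0 + rg * C
    eq′ = trans (cong (f 0 +_) (*-comm rf C)) (trans eq (cong (g 0 +_) (*-comm C rg)))
    go : ∀ j → j < suc L → f j ≡ g j
    go zero _ = begin
      f 0                   ≡⟨ m<n⇒[m+kn]%n≡m rf C (f< 0 (s≤s z≤n)) ⟨
      (f 0 + rf * C) % C    ≡⟨ cong (_% C) eq′ ⟩
      (g 0 + rg * C) % C    ≡⟨ m<n⇒[m+kn]%n≡m rg C (g< 0 (s≤s z≤n)) ⟩
      g 0                   ∎
      where open ≡-Reasoning
    go (suc j) (s≤s j<) = fromDigits-injective L (λ j j< → f< (suc j) (s≤s j<)) (λ j j< → g< (suc j) (s≤s j<))
      (begin
        rf                  ≡⟨ m<n⇒[m+kn]/n≡k rf C (f< 0 (s≤s z≤n)) ⟨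
        (f 0 + rf * C) / C  ≡⟨ cong (_/ C) eq′ ⟩
        (g 0 + rg * C) / C  ≡⟨ m<n⇒[m+kn]/n≡k rg C (g< 0 (s≤s z≤n)) ⟩
        rg                  ∎) j j<
      where open ≡-Reasoning

  toDigits-suc : ∀ x j → toDigits x (suc j) ≡ toDigits (x / C) j
  toDigits-suc x j = cong (_% C) (sym (m/n/o≡m/[n*o] x C (C ^ j) {{_}} {{m^n≢0 C j}} {{m^n≢0 C (suc j)}}))

  fromDigits-toDigits : ∀ L x → x < C ^ L → fromDigits C L (toDigits x) ≡ x
  fromDigits-toDigits zero x x<1 = sym (n<1⇒n≡0 x<1)
  fromDigits-toDigits (suc L) x x< = begin
      toDigits x 0 + C * fromDigits C L (λ j → toDigits x (suc j))
    ≡⟨ cong₂ (λ a b → a + C * b) (cong (_% C) (n/1≡n x)) (fromDigits-cong C L (λ j _ → toDigits-suc x j)) ⟩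
      x % C + C * fromDigits C L (toDigits (x / C))
    ≡⟨ cong (λ z → x % C + C * z) (fromDigits-toDigits L (x / C) (m<n*o⇒m/o<n (subst (x <_) (*-comm C (C ^ L)) x<))) ⟩
      x % C + C * (x / C)
    ≡⟨ m%n+n*[m/n]≡m x C ⟩
      x
    ∎
    where open ≡-Reasoning

  toDigits-fromDigits : ∀ L f → (∀ j → j < L → f j < C) → ∀ j → j < L → toDigits (fromDigits C L f) j ≡ f j
  toDigits-fromDigits L f f< =
    fromDigits-injective L (λ j _ → toDigits< _ j) f< (fromDigits-toDigits L _ (fromDigits< C L f f<))

andBits-fromDigits : ∀ W L f g → (∀ j → j < L → f j < 2 ^ W) → (∀ j → j < L → g j < 2 ^ W) →
  andBits (L * W) (fromDigits (2 ^ W) L f) (fromDigits (2 ^ W) L g) ≡ fromDigits (2 ^ W) L (λ j → andBits W (f j) (g j))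
andBits-fromDigits W zero f g f< g< = refl
andBits-fromDigits W (suc L) f g f< g< = begin
    andBits (W + L * W) (f 0 + C * rf) (g 0 + C * rg)
  ≡⟨ andBits-+ W (L * W) _ _ ⟩
    andBits W (f 0 + C * rf) (g 0 + C * rg) + C * andBits (L * W) ((f 0 + C * rf) /2^ W) ((g 0 + C * rg) /2^ W)
  ≡⟨ cong₂ (λ a b → a + C * b)
       (trans (andBits-ignores-highˡ W (f 0) rf _) (andBits-ignores-highʳ W (f 0) (g 0) rg))
       (cong₂ (andBits (L * W)) (high-part (f 0) rf (f< 0 (s≤s z≤n))) (high-part (g 0) rg (g< 0 (s≤s z≤n)))) ⟩
    andBits W (f 0) (g 0) + C * andBits (L * W) rf rg
  ≡⟨ cong (λ z → andBits W (f 0) (g 0) + C * z)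
       (andBits-fromDigits W L _ _ (λ j j< → f< (suc j) (s≤s j<)) (λ j j< → g< (suc j) (s≤s j<))) ⟩
    andBits W (f 0) (g 0) + C * fromDigits C L (λ j → andBits W (f (suc j)) (g (suc j)))
  ∎
  where
  open ≡-Reasoning
  C = 2 ^ W
  rf = fromDigits C L (λ j → f (suc j))
  rg = fromDigits C L (λ j → g (suc j))
  high-part : ∀ a r → a < C → (a + C * r) /2^ W ≡ r
  high-part a r a< = trans (cong (λ z → (a + z) /2^ W) (*-comm C r)) (m<n⇒[m+kn]/n≡k r C {{2^≢0 W}} a<)

-- Subtraction as the language computes it: adding the complement (N − 1) − q and then 1.
twos-complement-∸ : ∀ N .{{_ : NonZero N}} {P Q Z} → P ≡ Z + Q → Z < N →
  ((P % N + (N ∸ 1 ∸ Q % N)) % N + 1) % N ≡ Z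
twos-complement-∸ N@(suc N-1) {P} {Q} {Z} P≡Z+Q Z<N = begin
    ((P % N + (N-1 ∸ q)) % N + 1) % N   ≡⟨ [m%n+o]%n≡[m+o]%n (P % N + (N-1 ∸ q)) 1 N ⟩
    (P % N + (N-1 ∸ q) + 1) % N         ≡⟨ cong (_% N) (+-assoc (P % N) (N-1 ∸ q) 1) ⟩
    (P % N + (N-1 ∸ q + 1)) % N         ≡⟨ cong (λ z → (P % N + z) % N) complement+1 ⟩
    (P % N + (N ∸ q)) % N               ≡⟨ [m%n+o]%n≡[m+o]%n P (N ∸ q) N ⟩
    (P + (N ∸ q)) % N                   ≡⟨ cong (_% N) P+[N∸q]≡ ⟩
    (Z + suc (Q / N) * N) % N           ≡⟨ m<n⇒[m+kn]%n≡m (suc (Q / N)) N Z<N ⟩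
    Z                                   ∎
  where
  open ≡-Reasoning
  q = Q % N
  q≤N-1 : q ≤ N-1
  q≤N-1 = ≤-pred (m%n<n Q N)
  complement+1 : N-1 ∸ q + 1 ≡ N ∸ q
  complement+1 = sym (trans (cong (_∸ q) (+-comm 1 N-1)) (+-∸-comm 1 q≤N-1))
  regroup : ∀ a b c d → a + (b + c) + d ≡ a + (c + (b + d))
  regroup = solve-∀
  P+[N∸q]≡ : P + (N ∸ q) ≡ Z + suc (Q / N) * N
  P+[N∸q]≡ = begin
    P + (N ∸ q)                  ≡⟨ cong (_+ (N ∸ q)) (trans P≡Z+Q (cong (Z +_) (m≡m%n+[m/n]*n Q N))) ⟩
    Z + (q + Q / N * N) + (N ∸ q) ≡⟨ regroup Z q (Q / N * N) (N ∸ q) ⟩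
    Z + (Q / N * N + (q + (N ∸ q))) ≡⟨ cong (λ z → Z + (Q / N * N + z)) (m+[n∸m]≡n (≤-trans q≤N-1 (n≤1+n N-1))) ⟩
    Z + (Q / N * N + N)          ≡⟨ cong (Z +_) (+-comm (Q / N * N) N) ⟩
    Z + suc (Q / N) * N          ∎

[m%N+[N∸1]]%N≡m∸1 : ∀ N .{{_ : NonZero N}} {m} → 1 ≤ m → m ≤ N → (m % N + (N ∸ 1)) % N ≡ m ∸ 1
[m%N+[N∸1]]%N≡m∸1 N@(suc N-1) {suc m-1} _ m≤N with m≤n⇒m<n∨m≡n m≤N
... | inj₁ m<N = begin
    (suc m-1 % N + N-1) % N  ≡⟨ cong (λ z → (z + N-1) % N) (m<n⇒m%n≡m m<N) ⟩
    (suc m-1 + N-1) % N      ≡⟨ cong (_% N) (regroup m-1 N-1) ⟩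
    (m-1 + 1 * N) % N        ≡⟨ m<n⇒[m+kn]%n≡m 1 N (<-trans (n<1+n m-1) m<N) ⟩
    m-1                      ∎
  where open ≡-Reasoning
        regroup : ∀ m N → suc m + N ≡ m + 1 * suc N
        regroup = solve-∀
... | inj₂ refl = trans (cong (λ z → (z + N-1) % N) (n%n≡0 N)) (m<n⇒m%n≡m (n<1+n N-1))

n<2^n : ∀ n → n < 2 ^ n
n<2^n zero = s≤s z≤n
n<2^n (suc n) = begin
    2 + n          ≤⟨ +-monoʳ-≤ 1 (n<2^n n) ⟩
    1 + 2 ^ n      ≤⟨ +-monoˡ-≤ (2 ^ n) (m^n>0 2 n) ⟩
    2 ^ n + 2 ^ n  ≡⟨ cong (2 ^ n +_) (+-identityʳ (2 ^ n)) ⟨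
    2 ^ suc n      ∎
  where open ≤-Reasoning

m<n⇒m≤n∸1 : ∀ {m n} → m < n → m ≤ n ∸ 1
m<n⇒m≤n∸1 {n = suc n} (s≤s m≤n) = m≤n

2^-cancel-≤ : ∀ {m n} → 2 ^ m ≤ 2 ^ n → m ≤ n
2^-cancel-≤ {m} {n} 2^m≤2^n with m ≤? n
... | yes m≤n = m≤n
... | no m≰n = ⊥-elim (<⇒≱ (^-monoʳ-< 2 (s≤s (s≤s z≤n)) (≰⇒> m≰n)) 2^m≤2^n)

∀<2L⇔∀pairs<L : ∀ (P : ℕ → Set) L →
  (∀ k → k < 2 * L → P k) ⇔ (∀ j → j < L → P (2 * j) × P (suc (2 * j)))
∀<2L⇔∀pairs<L P L = mk⇔ pairs all
  where
  pairs : (∀ k → k < 2 * L → P k) → ∀ j → j < L → P (2 * j) × P (suc (2 * j))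
  pairs h j j<L = h (2 * j) (*-monoʳ-< 2 j<L) , h (suc (2 * j)) (subst (_≤ 2 * L) (*-suc 2 j) (*-monoʳ-≤ 2 j<L))
  even-or-odd : ∀ k → ∃[ j ] (k ≡ 2 * j ⊎ k ≡ suc (2 * j))
  even-or-odd zero = 0 , inj₁ refl
  even-or-odd (suc k) with even-or-odd k
  ... | j , inj₁ k≡2j = j , inj₂ (cong suc k≡2j)
  ... | j , inj₂ k≡2j+1 = suc j , inj₁ (trans (cong suc k≡2j+1) (sym (*-suc 2 j)))
  all : (∀ j → j < L → P (2 * j) × P (suc (2 * j))) → ∀ k → k < 2 * L → P k
  all h k k<2L with even-or-odd k
  ... | j , inj₁ refl = proj₁ (h j (*-cancelˡ-< 2 j L k<2L))
  ... | j , inj₂ refl = proj₂ (h j (*-cancelˡ-< 2 j L (<-trans (n<1+n _) k<2L)))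

module Blocks (T-1 L n : ℕ) (n≡L*W : n ≡ L * (suc T-1 + suc T-1)) where

  T W B C M : ℕ
  T = suc T-1
  W = T + T
  B = 2 ^ T
  C = 2 ^ W
  M = 2 ^ n

  instance
    B≢0 : NonZero B
    B≢0 = 2^≢0 T
    C≢0 : NonZero C
    C≢0 = 2^≢0 W
    M≢0 : NonZero M
    M≢0 = 2^≢0 n

  2≤B : 2 ≤ B
  2≤B = *-monoʳ-≤ 2 (m^n>0 2 T-1)

  C≡B*B : C ≡ B * B
  C≡B*B = ^-distribˡ-+-* 2 T T

  B<C : B < C
  B<C = subst (B <_) (sym C≡B*B) (m<m*n B B 2≤B)

  B+B≤C : B + B ≤ C
  B+B≤C = begin
      B + B   ≡⟨ cong (B +_) (+-identityʳ B) ⟨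
      2 * B   ≡⟨ *-comm 2 B ⟩
      B * 2   ≤⟨ *-monoʳ-≤ B 2≤B ⟩
      B * B   ≡⟨ C≡B*B ⟨
      C       ∎
    where open ≤-Reasoning

  B∸1<B : B ∸ 1 < B
  B∸1<B = ≤-reflexive (m+[n∸m]≡n (m^n>0 2 T))

  M≡C^L : M ≡ C ^ L
  M≡C^L = trans (cong (2 ^_) (trans n≡L*W (*-comm L W))) (sym (^-*-assoc 2 W L))

  andBits-n : ∀ a b → andBits n a b ≡ andBits (L * W) a b
  andBits-n a b = cong (λ f → andBits f a b) n≡L*W

  <B⇒<C : ∀ {a} → a < B → a < C
  <B⇒<C a<B = <-trans a<B B<C

  /B<B : ∀ {c} → c < C → c / B < B
  /B<B {c} c<C = m<n*o⇒m/o<n (subst (c <_) C≡B*B c<C)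

  andBits-lowMask : ∀ c → andBits W c (B ∸ 1) ≡ c % B
  andBits-lowMask c = begin
      andBits W c (B ∸ 1)
    ≡⟨ andBits-+ T T c (B ∸ 1) ⟩
      andBits T c (B ∸ 1) + B * andBits T (c / B) ((B ∸ 1) / B)
    ≡⟨ cong (λ z → andBits T c (B ∸ 1) + B * andBits T (c / B) z) (m<n⇒m/n≡0 B∸1<B) ⟩
      andBits T c (B ∸ 1) + B * andBits T (c / B) 0
    ≡⟨ cong (λ z → andBits T c (B ∸ 1) + B * z) (andBits-zeroʳ T (c / B)) ⟩
      andBits T c (B ∸ 1) + B * 0
    ≡⟨ trans (cong (andBits T c (B ∸ 1) +_) (*-zeroʳ B)) (+-identityʳ _) ⟩
      andBits T c (B ∸ 1)
    ≡⟨ andBits-ones T c ⟩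
      c % B
    ∎
    where open ≡-Reasoning

  andBits-highMask : ∀ {c} → c < C → andBits W c (B * (B ∸ 1)) ≡ B * (c / B)
  andBits-highMask {c} c<C = begin
      andBits W c (B * (B ∸ 1))
    ≡⟨ andBits-+ T T c _ ⟩
      andBits T c (B * (B ∸ 1)) + B * andBits T (c / B) (B * (B ∸ 1) / B)
    ≡⟨ cong₂ (λ u v → u + B * andBits T (c / B) v)
         (trans (andBits-ignores-highʳ T c 0 (B ∸ 1)) (andBits-zeroʳ T c))
         (trans (cong (_/ B) (*-comm B (B ∸ 1))) (m*n/n≡m (B ∸ 1) B)) ⟩
      B * andBits T (c / B) (B ∸ 1)
    ≡⟨ cong (B *_) (trans (andBits-ones T (c / B)) (m<n⇒m%n≡m (/B<B c<C))) ⟩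
      B * (c / B)
    ∎
    where open ≡-Reasoning

  andBits-flag : ∀ w → andBits W w B ≡ B * (w / B % 2)
  andBits-flag w = begin
      andBits W w B
    ≡⟨ andBits-+ T T w B ⟩
      andBits T w B + B * andBits T (w / B) (B / B)
    ≡⟨ cong₂ (λ u v → u + B * andBits T (w / B) v)
         (trans (cong (andBits T w) (sym (*-identityʳ B))) (trans (andBits-ignores-highʳ T w 0 1) (andBits-zeroʳ T w)))
         (n/n≡1 B) ⟩
      B * andBits T (w / B) 1
    ≡⟨ cong (B *_) (andBits-one T-1 (w / B)) ⟩
      B * (w / B % 2)
    ∎
    where open ≡-Reasoning

  -- What the terms of the formulas ψ₀, ψ₁ below denote in M_d when t < d.
  infixl 6 _+ₘ_
  infix 8 ~ₘ_
  _+ₘ_ : ℕ → ℕ → ℕ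
  x +ₘ y = (x + y) % M
  ~ₘ_ : ℕ → ℕ
  ~ₘ u = (M ∸ 1) ∸ u

  Q flags lowMask highMask : ℕ
  Q = repunit C L
  flags = B * Q
  lowMask = (B ∸ 1) * Q
  highMask = B * lowMask

  lowHalves highHalves : ℕ → ℕ
  lowHalves x = andBits n x lowMask
  highHalves x = andBits n x highMask / B

  borrowTest : ℕ → ℕ → ℕ
  borrowTest u v = v +ₘ flags +ₘ ~ₘ u +ₘ 1

  BlockwiseLe : ℕ → ℕ → Set
  BlockwiseLe u v = andBits n (borrowTest u v) flags ≡ flags

  HalvesLe : ℕ → ℕ → Set
  HalvesLe x y = BlockwiseLe (lowHalves x) (lowHalves y) × BlockwiseLe (highHalves x) (highHalves y)

  xorₘ : ℕ → ℕ → ℕ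
  xorₘ a b = a +ₘ b +ₘ ~ₘ (andBits n a b +ₘ andBits n a b) +ₘ 1

  ones : ℕ
  ones = Q +ₘ flags

  fromDigits<M : ∀ f → (∀ j → j < L → f j < C) → fromDigits C L f < M
  fromDigits<M f f< = subst (fromDigits C L f <_) (sym M≡C^L) (fromDigits< C L f f<)

  block : ℕ → ℕ → ℕ
  block = toDigits C

  fromDigits-block : ∀ {x} → x < M → fromDigits C L (block x) ≡ x
  fromDigits-block {x} x<M = fromDigits-toDigits C L x (subst (x <_) M≡C^L x<M)

  block-fromDigits : ∀ f → (∀ j → j < L → f j < C) → ∀ j → j < L → block (fromDigits C L f) j ≡ f j
  block-fromDigits = toDigits-fromDigits C L

  borrow-set : ∀ {u v} → v < B → u ≤ v → (B + v ∸ u) / B ≡ 1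
  borrow-set {u} {v} v<B u≤v = trans (cong (_/ B) B+v∸u≡) (m<n⇒[m+kn]/n≡k 1 B (≤-<-trans (m∸n≤m v u) v<B))
    where B+v∸u≡ : B + v ∸ u ≡ v ∸ u + 1 * B
          B+v∸u≡ = trans (+-∸-assoc B u≤v) (trans (+-comm B (v ∸ u)) (cong (v ∸ u +_) (sym (+-identityʳ B))))

  borrow-clear : ∀ {u v} → v < u → (B + v ∸ u) / B ≡ 0
  borrow-clear {u} {v} v<u = m<n⇒m/n≡0 (begin-strict
      B + v ∸ u         ≤⟨ ∸-monoʳ-≤ (B + v) (subst (_≤ u) (+-comm 1 v) v<u) ⟩
      B + v ∸ (v + 1)   ≡⟨ ∸-+-assoc (B + v) v 1 ⟨
      B + v ∸ v ∸ 1     ≡⟨ cong (_∸ 1) (m+n∸n≡m B v) ⟩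
      B ∸ 1             <⟨ B∸1<B ⟩
      B                 ∎)
    where open ≤-Reasoning

  module _ (u v : ℕ → ℕ) (u<B : ∀ j → j < L → u j < B) (v<B : ∀ j → j < L → v j < B) where

    private
      U V : ℕ
      U = fromDigits C L u
      V = fromDigits C L v
      diff : ℕ → ℕ
      diff j = B + v j ∸ u j
      diff<C : ∀ j → j < L → diff j < C
      diff<C j j< = ≤-<-trans (m∸n≤m (B + v j) (u j)) (<-≤-trans (+-monoʳ-< B (v<B j j<)) B+B≤C)

    borrowTest-fromDigits : borrowTest U V ≡ fromDigits C L diff
    borrowTest-fromDigits = trans (cong (λ z → (V + flags) % M +ₘ (M ∸ 1 ∸ z) +ₘ 1)
                                        (sym (m<n⇒m%n≡m (fromDigits<M u (λ j j< → <B⇒<C (u<B j j<))))))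
                                  (twos-complement-∸ M V+flags≡ (fromDigits<M diff diff<C))
      where
      open ≡-Reasoning
      V+flags≡ : V + flags ≡ fromDigits C L diff + U
      V+flags≡ = begin
          V + flags                              ≡⟨ cong (V +_) (fromDigits-const C L B) ⟨
          V + fromDigits C L (λ _ → B)           ≡⟨ fromDigits-+ C L v (λ _ → B) ⟨
          fromDigits C L (λ j → v j + B)         ≡⟨ fromDigits-cong C L (λ j j< →
                                                      trans (+-comm (v j) B) (sym (m∸n+n≡m (≤-trans (<⇒≤ (u<B j j<)) (m≤m+n B (v j)))))) ⟩
          fromDigits C L (λ j → diff j + u j)    ≡⟨ fromDigits-+ C L diff u ⟩
          fromDigits C L diff + U                ∎

    flags-of-borrowTest : andBits n (borrowTest U V) flags ≡ fromDigits C L (λ j → B * (diff j / B % 2))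
    flags-of-borrowTest = begin
        andBits n (borrowTest U V) flags
      ≡⟨ cong₂ (andBits n) borrowTest-fromDigits (sym (fromDigits-const C L B)) ⟩
        andBits n (fromDigits C L diff) (fromDigits C L (λ _ → B))
      ≡⟨ andBits-n _ _ ⟩
        andBits (L * W) (fromDigits C L diff) (fromDigits C L (λ _ → B))
      ≡⟨ andBits-fromDigits W L diff (λ _ → B) diff<C (λ _ _ → B<C) ⟩
        fromDigits C L (λ j → andBits W (diff j) B)
      ≡⟨ fromDigits-cong C L (λ j _ → andBits-flag (diff j)) ⟩
        fromDigits C L (λ j → B * (diff j / B % 2))
      ∎
      where open ≡-Reasoning

    blockwiseLe⇔ : BlockwiseLe U V ⇔ (∀ j → j < L → u j ≤ v j)
    blockwiseLe⇔ = mk⇔ flags⇒≤ ≤⇒flags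
      where
      ≤⇒flags : (∀ j → j < L → u j ≤ v j) → BlockwiseLe U V
      ≤⇒flags u≤v = trans flags-of-borrowTest (trans (fromDigits-cong C L (λ j j< →
        trans (cong (λ z → B * (z % 2)) (borrow-set (v<B j j<) (u≤v j j<))) (*-identityʳ B))) (fromDigits-const C L B))
      flag<C : ∀ j → j < L → B * (diff j / B % 2) < C
      flag<C j _ = ≤-<-trans (≤-trans (*-monoʳ-≤ B (m%2≤1 (diff j / B))) (≤-reflexive (*-identityʳ B))) B<C
      flags⇒≤ : BlockwiseLe U V → ∀ j → j < L → u j ≤ v j
      flags⇒≤ masked≡flags j j< with u j ≤? v j
      ... | yes u≤v = u≤v
      ... | no u≰v = ⊥-elim (<⇒≢ (m^n>0 2 T) (begin
          0                        ≡⟨ *-zeroʳ B ⟨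
          B * (0 % 2)              ≡⟨ cong (λ z → B * (z % 2)) (borrow-clear (≰⇒> u≰v)) ⟨
          B * (diff j / B % 2)     ≡⟨ fromDigits-injective C L flag<C (λ _ _ → B<C)
                                        (trans (sym flags-of-borrowTest) (trans masked≡flags (sym (fromDigits-const C L B)))) j j< ⟩
          B                        ∎))
        where open ≡-Reasoning

  lowHalves-block : ∀ {x} → x < M → lowHalves x ≡ fromDigits C L (λ j → block x j % B)
  lowHalves-block {x} x<M = begin
      andBits n x lowMask
    ≡⟨ cong₂ (andBits n) (sym (fromDigits-block x<M)) (sym (fromDigits-const C L (B ∸ 1))) ⟩
      andBits n (fromDigits C L (block x)) (fromDigits C L (λ _ → B ∸ 1))
    ≡⟨ andBits-n _ _ ⟩
      andBits (L * W) (fromDigits C L (block x)) (fromDigits C L (λ _ → B ∸ 1))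
    ≡⟨ andBits-fromDigits W L (block x) (λ _ → B ∸ 1) (λ j _ → toDigits< C x j) (λ _ _ → <B⇒<C B∸1<B) ⟩
      fromDigits C L (λ j → andBits W (block x j) (B ∸ 1))
    ≡⟨ fromDigits-cong C L (λ j _ → andBits-lowMask (block x j)) ⟩
      fromDigits C L (λ j → block x j % B)
    ∎
    where open ≡-Reasoning

  highHalves-block : ∀ {x} → x < M → highHalves x ≡ fromDigits C L (λ j → block x j / B)
  highHalves-block {x} x<M = begin
      andBits n x highMask / B
    ≡⟨ cong (λ z → andBits n x z / B) (trans (cong (B *_) (sym (fromDigits-const C L (B ∸ 1))))
                                              (sym (fromDigits-* C L B (λ _ → B ∸ 1)))) ⟩
      andBits n x (fromDigits C L (λ _ → B * (B ∸ 1))) / B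
    ≡⟨ cong (λ z → andBits n z (fromDigits C L (λ _ → B * (B ∸ 1))) / B) (sym (fromDigits-block x<M)) ⟩
      andBits n (fromDigits C L (block x)) (fromDigits C L (λ _ → B * (B ∸ 1))) / B
    ≡⟨ cong (_/ B) (andBits-n _ _) ⟩
      andBits (L * W) (fromDigits C L (block x)) (fromDigits C L (λ _ → B * (B ∸ 1))) / B
    ≡⟨ cong (_/ B) (andBits-fromDigits W L (block x) (λ _ → B * (B ∸ 1)) (λ j _ → toDigits< C x j) (λ _ _ → BB-1<C)) ⟩
      fromDigits C L (λ j → andBits W (block x j) (B * (B ∸ 1))) / B
    ≡⟨ cong (_/ B) (fromDigits-cong C L (λ j _ → andBits-highMask (toDigits< C x j))) ⟩
      fromDigits C L (λ j → B * (block x j / B)) / B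
    ≡⟨ cong (_/ B) (trans (fromDigits-* C L B (λ j → block x j / B)) (*-comm B _)) ⟩
      fromDigits C L (λ j → block x j / B) * B / B
    ≡⟨ m*n/n≡m _ B ⟩
      fromDigits C L (λ j → block x j / B)
    ∎
    where
    open ≡-Reasoning
    BB-1<C : B * (B ∸ 1) < C
    BB-1<C = subst (B * (B ∸ 1) <_) (sym C≡B*B) (*-monoʳ-< B B∸1<B)

  halvesLe⇔ : ∀ {x y} → x < M → y < M →
    HalvesLe x y ⇔ (∀ j → j < L → (block x j % B ≤ block y j % B) × (block x j / B ≤ block y j / B))
  halvesLe⇔ {x} {y} x<M y<M = mk⇔
    (λ (lo , hi) j j< → Equivalence.to (⇔.trans lo≡ low-test) lo j j< , Equivalence.to (⇔.trans hi≡ high-test) hi j j<)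
    (λ h → Equivalence.from (⇔.trans lo≡ low-test) (λ j j< → proj₁ (h j j<)) ,
           Equivalence.from (⇔.trans hi≡ high-test) (λ j j< → proj₂ (h j j<)))
    where
    low-test = blockwiseLe⇔ (λ j → block x j % B) (λ j → block y j % B)
                 (λ j _ → m%n<n (block x j) B) (λ j _ → m%n<n (block y j) B)
    high-test = blockwiseLe⇔ (λ j → block x j / B) (λ j → block y j / B)
                 (λ j _ → /B<B (toDigits< C x j)) (λ j _ → /B<B (toDigits< C y j))
    lo≡ = ≡⇒⇔ (cong₂ BlockwiseLe (lowHalves-block x<M) (lowHalves-block y<M))
    hi≡ = ≡⇒⇔ (cong₂ BlockwiseLe (highHalves-block x<M) (highHalves-block y<M))

  ∃xor<B : ∀ {x y} → x < B → y < B → ∃[ X ] X < B × x + y ≡ X + 2 * andBits T x y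
  ∃xor<B {x} {y} x<B y<B with ∃xor T x y
  ... | X , X<B , sum≡ = X , X<B , trans (sym (cong₂ _+_ (m<n⇒m%n≡m x<B) (m<n⇒m%n≡m y<B))) sum≡

  nonzero⇔≢ : ∀ {x y X} → x < B → y < B → x + y ≡ X + 2 * andBits T x y → 1 ≤ X ⇔ x ≢ y
  nonzero⇔≢ x<B y<B sum≡ = mk⇔ (λ 1≤X x≡y → <⇒≢ 1≤X (sym (Equivalence.from X≡0⇔ x≡y)))
                                (λ x≢y → n≢0⇒n>0 (λ X≡0 → x≢y (Equivalence.to X≡0⇔ X≡0)))
    where X≡0⇔ = xor≡0⇔≡ T x<B y<B sum≡

  andBits-W : ∀ c e → andBits W c e ≡ andBits T (c % B) (e % B) + B * andBits T (c / B) (e / B)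
  andBits-W c e = trans (andBits-+ T T c e) (cong (_+ B * andBits T (c / B) (e / B)) (andBits-%2^ T c e))

  record BlockXor (c e : ℕ) : Set where
    field
      value : ℕ
      value<C : value < C
      sum≡ : c + e ≡ value + 2 * andBits W c e
      low≢ : 1 ≤ value % B ⇔ c % B ≢ e % B
      high≢ : 1 ≤ value / B ⇔ c / B ≢ e / B

  blockXor : ∀ {c e} → c < C → e < C → BlockXor c e
  blockXor {c} {e} c<C e<C = record
    { value = X
    ; value<C = X<C
    ; sum≡ = sum≡
    ; low≢ = ⇔.trans (≡⇒⇔ (cong (1 ≤_) X%B≡)) (nonzero⇔≢ (m%n<n c B) (m%n<n e B) low-sum≡)
    ; high≢ = ⇔.trans (≡⇒⇔ (cong (1 ≤_) X/B≡)) (nonzero⇔≢ (/B<B c<C) (/B<B e<C) high-sum≡)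
    }
    where
    lo = ∃xor<B (m%n<n c B) (m%n<n e B)
    hi = ∃xor<B (/B<B c<C) (/B<B e<C)
    Xlo = proj₁ lo
    Xhi = proj₁ hi
    Xlo<B = proj₁ (proj₂ lo)
    Xhi<B = proj₁ (proj₂ hi)
    low-sum≡ = proj₂ (proj₂ lo)
    high-sum≡ = proj₂ (proj₂ hi)
    X = Xlo + B * Xhi
    X<C : X < C
    X<C = begin-strict
        Xlo + B * Xhi   <⟨ +-monoˡ-< (B * Xhi) Xlo<B ⟩
        B + B * Xhi     ≡⟨ *-suc B Xhi ⟨
        B * suc Xhi     ≤⟨ *-monoʳ-≤ B Xhi<B ⟩
        B * B           ≡⟨ C≡B*B ⟨
        C               ∎
      where open ≤-Reasoning
    regroup₁ : ∀ a b c d B → (a + B * b) + (c + B * d) ≡ (a + c) + B * (b + d)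
    regroup₁ = solve-∀
    regroup₂ : ∀ a b p q B → (a + 2 * p) + B * (b + 2 * q) ≡ (a + B * b) + 2 * (p + B * q)
    regroup₂ = solve-∀
    sum≡ : c + e ≡ X + 2 * andBits W c e
    sum≡ = begin
        c + e
      ≡⟨ cong₂ _+_ (sym (m%n+n*[m/n]≡m c B)) (sym (m%n+n*[m/n]≡m e B)) ⟩
        (c % B + B * (c / B)) + (e % B + B * (e / B))
      ≡⟨ regroup₁ (c % B) (c / B) (e % B) (e / B) B ⟩
        (c % B + e % B) + B * (c / B + e / B)
      ≡⟨ cong₂ (λ u v → u + B * v) low-sum≡ high-sum≡ ⟩
        (Xlo + 2 * andBits T (c % B) (e % B)) + B * (Xhi + 2 * andBits T (c / B) (e / B))
      ≡⟨ regroup₂ Xlo Xhi (andBits T (c % B) (e % B)) (andBits T (c / B) (e / B)) B ⟩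
        X + 2 * (andBits T (c % B) (e % B) + B * andBits T (c / B) (e / B))
      ≡⟨ cong (λ z → X + 2 * z) (andBits-W c e) ⟨
        X + 2 * andBits W c e
      ∎
      where open ≡-Reasoning
    X%B≡ : X % B ≡ Xlo
    X%B≡ = trans (cong (λ z → (Xlo + z) % B) (*-comm B Xhi)) (m<n⇒[m+kn]%n≡m Xhi B Xlo<B)
    X/B≡ : X / B ≡ Xhi
    X/B≡ = trans (cong (λ z → (Xlo + z) / B) (*-comm B Xhi)) (m<n⇒[m+kn]/n≡k Xhi B Xlo<B)

  xorDigits : ℕ → ℕ → ℕ → ℕ
  xorDigits a b j = BlockXor.value (blockXor (toDigits< C a j) (toDigits< C b j))

  xorDigits<C : ∀ a b j → xorDigits a b j < C
  xorDigits<C a b j = BlockXor.value<C (blockXor (toDigits< C a j) (toDigits< C b j))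

  xorₘ-fromDigits : ∀ {a b} → a < M → b < M → xorₘ a b ≡ fromDigits C L (xorDigits a b)
  xorₘ-fromDigits {a} {b} a<M b<M =
    twos-complement-∸ M a+b≡ (fromDigits<M (xorDigits a b) (λ j _ → xorDigits<C a b j))
    where
    open ≡-Reasoning
    A = andBits n a b
    carries : ℕ → ℕ
    carries j = andBits W (block a j) (block b j)
    fromDigits-carries : fromDigits C L carries ≡ A
    fromDigits-carries = begin
        fromDigits C L carries
      ≡⟨ andBits-fromDigits W L (block a) (block b) (λ j _ → toDigits< C a j) (λ j _ → toDigits< C b j) ⟨
        andBits (L * W) (fromDigits C L (block a)) (fromDigits C L (block b))
      ≡⟨ andBits-n _ _ ⟨
        andBits n (fromDigits C L (block a)) (fromDigits C L (block b))
      ≡⟨ cong₂ (andBits n) (fromDigits-block a<M) (fromDigits-block b<M) ⟩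
        A
      ∎
    a+b≡ : a + b ≡ fromDigits C L (xorDigits a b) + (A + A)
    a+b≡ = begin
        a + b
      ≡⟨ cong₂ _+_ (fromDigits-block a<M) (fromDigits-block b<M) ⟨
        fromDigits C L (block a) + fromDigits C L (block b)
      ≡⟨ fromDigits-+ C L (block a) (block b) ⟨
        fromDigits C L (λ j → block a j + block b j)
      ≡⟨ fromDigits-cong C L (λ j _ → BlockXor.sum≡ (blockXor (toDigits< C a j) (toDigits< C b j))) ⟩
        fromDigits C L (λ j → xorDigits a b j + 2 * carries j)
      ≡⟨ fromDigits-+ C L (xorDigits a b) (λ j → 2 * carries j) ⟩
        fromDigits C L (xorDigits a b) + fromDigits C L (λ j → 2 * carries j)
      ≡⟨ cong (fromDigits C L (xorDigits a b) +_) (trans (fromDigits-* C L 2 carries) (cong (2 *_) fromDigits-carries)) ⟩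
        fromDigits C L (xorDigits a b) + 2 * A
      ≡⟨ cong (λ z → fromDigits C L (xorDigits a b) + (A + z)) (+-identityʳ A) ⟩
        fromDigits C L (xorDigits a b) + (A + A)
      ∎

  1+B<C : 1 + B < C
  1+B<C = ≤-trans (+-monoˡ-≤ B 2≤B) B+B≤C

  ones-fromDigits : ones ≡ fromDigits C L (λ _ → 1 + B)
  ones-fromDigits = trans (cong (_% M) Q+flags≡) (m<n⇒m%n≡m (fromDigits<M _ (λ _ _ → 1+B<C)))
    where Q+flags≡ : Q + flags ≡ fromDigits C L (λ _ → 1 + B)
          Q+flags≡ = sym (trans (fromDigits-+ C L (λ _ → 1) (λ _ → B)) (cong (Q +_) (fromDigits-const C L B)))

  halvesLe-ones-xor⇔ : ∀ {a b} → a < M → b < M →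
    HalvesLe ones (xorₘ a b) ⇔ (∀ j → j < L → (block a j % B ≢ block b j % B) × (block a j / B ≢ block b j / B))
  halvesLe-ones-xor⇔ {a} {b} a<M b<M = ⇔.trans (halvesLe⇔ ones<M xor<M) (mk⇔
    (λ h j j< → Equivalence.to (low≢ j) (subst₂ _≤_ (ones-low j j<) (xor-low j j<) (proj₁ (h j j<))) ,
                Equivalence.to (high≢ j) (subst₂ _≤_ (ones-high j j<) (xor-high j j<) (proj₂ (h j j<))))
    (λ h j j< → subst₂ _≤_ (sym (ones-low j j<)) (sym (xor-low j j<)) (Equivalence.from (low≢ j) (proj₁ (h j j<))) ,
                subst₂ _≤_ (sym (ones-high j j<)) (sym (xor-high j j<)) (Equivalence.from (high≢ j) (proj₂ (h j j<)))))
    where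
    module X j = BlockXor (blockXor (toDigits< C a j) (toDigits< C b j))
    open X using (low≢; high≢)
    ones<M : ones < M
    ones<M = subst (_< M) (sym ones-fromDigits) (fromDigits<M _ (λ _ _ → 1+B<C))
    xor<M : xorₘ a b < M
    xor<M = subst (_< M) (sym (xorₘ-fromDigits a<M b<M)) (fromDigits<M _ (λ j _ → xorDigits<C a b j))
    1+B≡ : 1 + 1 * B ≡ 1 + B
    1+B≡ = cong (1 +_) (+-identityʳ B)
    block-ones : ∀ j → j < L → block ones j ≡ 1 + B
    block-ones j j< = trans (cong (λ z → block z j) ones-fromDigits) (block-fromDigits _ (λ _ _ → 1+B<C) j j<)
    ones-low : ∀ j → j < L → block ones j % B ≡ 1
    ones-low j j< = trans (cong (_% B) (trans (block-ones j j<) (sym 1+B≡))) (m<n⇒[m+kn]%n≡m 1 B 2≤B)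
    ones-high : ∀ j → j < L → block ones j / B ≡ 1
    ones-high j j< = trans (cong (_/ B) (trans (block-ones j j<) (sym 1+B≡))) (m<n⇒[m+kn]/n≡k 1 B 2≤B)
    block-xor : ∀ j → j < L → block (xorₘ a b) j ≡ xorDigits a b j
    block-xor j j< = trans (cong (λ z → block z j) (xorₘ-fromDigits a<M b<M))
                           (block-fromDigits _ (λ i _ → xorDigits<C a b i) j j<)
    xor-low : ∀ j → j < L → block (xorₘ a b) j % B ≡ X.value j % B
    xor-low j j< = cong (_% B) (block-xor j j<)
    xor-high : ∀ j → j < L → block (xorₘ a b) j / B ≡ X.value j / B
    xor-high j j< = cong (_/ B) (block-xor j j<)

  digitᴮ : ℕ → ℕ → ℕ
  digitᴮ a k = a /2^ (T * k) % B

  digitᴮ-even : ∀ a j → digitᴮ a (2 * j) ≡ block a j % B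
  digitᴮ-even a j = trans (cong (_% B) (/-congʳ {{2^≢0 (T * (2 * j))}} 2^[T*2j]≡C^j))
                          (sym (m∣n⇒o%n%m≡o%m B C (a / C ^ j) (divides B C≡B*B)))
    where
    regroup : ∀ T j → T * (2 * j) ≡ (T + T) * j
    regroup = solve-∀
    2^[T*2j]≡C^j : 2 ^ (T * (2 * j)) ≡ C ^ j
    2^[T*2j]≡C^j = trans (cong (2 ^_) (regroup T j)) (sym (^-*-assoc 2 W j))
    instance
      C^j≢0 : NonZero (C ^ j)
      C^j≢0 = m^n≢0 C j

  digitᴮ-odd : ∀ a j → digitᴮ a (suc (2 * j)) ≡ block a j / B
  digitᴮ-odd a j = begin
      a /2^ (T * suc (2 * j)) % B  ≡⟨ cong (_% B) (/-congʳ {{2^≢0 (T * suc (2 * j))}} 2^[T*[2j+1]]≡C^j*B) ⟩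
      a / (C ^ j * B) % B          ≡⟨ cong (_% B) (m/n/o≡m/[n*o] a (C ^ j) B) ⟨
      a / C ^ j / B % B            ≡⟨ m%[n*o]/o≡m/o%n (a / C ^ j) B B ⟨
      a / C ^ j % (B * B) / B      ≡⟨ cong (_/ B) (%-congʳ (sym C≡B*B)) ⟩
      block a j / B                ∎
    where
    open ≡-Reasoning
    regroup : ∀ T j → T * suc (2 * j) ≡ (T + T) * j + T
    regroup = solve-∀
    2^[T*[2j+1]]≡C^j*B : 2 ^ (T * suc (2 * j)) ≡ C ^ j * B
    2^[T*[2j+1]]≡C^j*B = trans (cong (2 ^_) (regroup T j))
      (trans (^-distribˡ-+-* 2 (W * j) T) (cong (_* B) (sym (^-*-assoc 2 W j))))
    instance
      C^j≢0 : NonZero (C ^ j)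
      C^j≢0 = m^n≢0 C j
      C^j*B≢0 : NonZero (C ^ j * B)
      C^j*B≢0 = subst NonZero 2^[T*[2j+1]]≡C^j*B (2^≢0 (T * suc (2 * j)))
      B*B≢0 : NonZero (B * B)
      B*B≢0 = subst NonZero C≡B*B C≢0

  digits⇔halves : ∀ (R : ℕ → ℕ → Set) a b →
    (∀ k → k < 2 * L → R (digitᴮ a k) (digitᴮ b k)) ⇔
    (∀ j → j < L → R (block a j % B) (block b j % B) × R (block a j / B) (block b j / B))
  digits⇔halves R a b = ⇔.trans (∀<2L⇔∀pairs<L (λ k → R (digitᴮ a k) (digitᴮ b k)) L) (mk⇔
    (λ h j j< → subst₂ R (digitᴮ-even a j) (digitᴮ-even b j) (proj₁ (h j j<)) ,
                subst₂ R (digitᴮ-odd a j) (digitᴮ-odd b j) (proj₂ (h j j<)))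
    (λ h j j< → subst₂ R (sym (digitᴮ-even a j)) (sym (digitᴮ-even b j)) (proj₁ (h j j<)) ,
                subst₂ R (sym (digitᴮ-odd a j)) (sym (digitᴮ-odd b j)) (proj₂ (h j j<))))

  halvesLe⇔digits≤ : ∀ {a b} → a < M → b < M → HalvesLe a b ⇔ (∀ k → k < 2 * L → digitᴮ a k ≤ digitᴮ b k)
  halvesLe⇔digits≤ {a} {b} a<M b<M = ⇔.trans (halvesLe⇔ a<M b<M) (⇔.sym (digits⇔halves _≤_ a b))

  halvesLe-ones-xor⇔digits≢ : ∀ {a b} → a < M → b < M →
    HalvesLe ones (xorₘ a b) ⇔ (∀ k → k < 2 * L → digitᴮ a k ≢ digitᴮ b k)
  halvesLe-ones-xor⇔digits≢ {a} {b} a<M b<M = ⇔.trans (halvesLe-ones-xor⇔ a<M b<M) (⇔.sym (digits⇔halves _≢_ a b))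

  2≤C : 2 ≤ C
  2≤C = ≤-trans 2≤B (<⇒≤ B<C)

  instance
    C∸1≢0 : NonZero (C ∸ 1)
    C∸1≢0 = >-nonZero (∸-monoˡ-≤ 1 2≤C)

  [M∸1]/[C∸1]≡Q : (M ∸ 1) / (C ∸ 1) ≡ Q
  [M∸1]/[C∸1]≡Q = trans (cong (_/ (C ∸ 1)) M∸1≡) (m*n/n≡m Q (C ∸ 1))
    where
    1+[C∸1]≡C : suc (C ∸ 1) ≡ C
    1+[C∸1]≡C = m+[n∸m]≡n (≤-trans (s≤s z≤n) 2≤C)
    M∸1≡ : M ∸ 1 ≡ Q * (C ∸ 1)
    M∸1≡ = begin
        M ∸ 1                                   ≡⟨ cong (_∸ 1) (trans M≡C^L (cong (_^ L) (sym 1+[C∸1]≡C))) ⟩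
        suc (C ∸ 1) ^ L ∸ 1                     ≡⟨ cong (_∸ 1) ([C∸1]*repunit+1≡C^L (C ∸ 1) L) ⟨
        (C ∸ 1) * repunit (suc (C ∸ 1)) L + 1 ∸ 1 ≡⟨ m+n∸n≡m _ 1 ⟩
        (C ∸ 1) * repunit (suc (C ∸ 1)) L       ≡⟨ cong (λ z → (C ∸ 1) * repunit z L) 1+[C∸1]≡C ⟩
        (C ∸ 1) * Q                             ≡⟨ *-comm (C ∸ 1) Q ⟩
        Q * (C ∸ 1)                             ∎
      where open ≡-Reasoning

arg₀ arg₁ arg₂ : Vector ℕ 3 → ℕ
arg₀ ρ = ρ F.zero
arg₁ ρ = ρ (F.suc F.zero)
arg₂ ρ = ρ (F.suc (F.suc F.zero))

𝐚 𝐛 𝐭 : Term 3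
𝐚 = var F.zero
𝐛 = var (F.suc F.zero)
𝐭 = var (F.suc (F.suc F.zero))

widthT baseT repunitT flagsT lowMaskT highMaskT onesT xorT : Term 3
widthT = ⟨p⟩ 𝐭
baseT = ⟨p⟩ widthT
repunitT = ⟨÷⟩ cm1 (⟨+⟩ (⟨×⟩ baseT baseT) cm1)
flagsT = ⟨×⟩ baseT repunitT
lowMaskT = ⟨×⟩ (⟨+⟩ baseT cm1) repunitT
highMaskT = ⟨×⟩ baseT lowMaskT
onesT = ⟨+⟩ repunitT flagsT
xorT = ⟨+⟩ (⟨+⟩ (⟨+⟩ 𝐚 𝐛) (⟨N⟩ (⟨+⟩ (⟨∩⟩ 𝐚 𝐛) (⟨∩⟩ 𝐚 𝐛)))) c1

lowHalvesT highHalvesT : Term 3 → Term 3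
lowHalvesT x = ⟨∩⟩ x lowMaskT
highHalvesT x = ⟨÷⟩ (⟨∩⟩ x highMaskT) baseT

borrowTestT : Term 3 → Term 3 → Term 3
borrowTestT u v = ⟨+⟩ (⟨+⟩ (⟨+⟩ v flagsT) (⟨N⟩ u)) c1

_≤ᶠ_ blockwiseLeᶠ halvesLeᶠ : Term 3 → Term 3 → QF 3
x ≤ᶠ y = ⟨max⟩ x y ≐ y
blockwiseLeᶠ u v = ⟨∩⟩ (borrowTestT u v) flagsT ≐ flagsT
halvesLeᶠ x y = blockwiseLeᶠ (lowHalvesT x) (lowHalvesT y) ∧ᶠ blockwiseLeᶠ (highHalvesT x) (highHalvesT y)

-- t < n guarantees that p(t) is 2^t and not the truncated value 2^n − 1.
t≤dᶠ t≡dᶠ : QF 3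
t≤dᶠ = (¬ᶠ (⟨max⟩ 𝐭 cn ≐ 𝐭)) ∧ᶠ (widthT ≤ᶠ cn)
t≡dᶠ = widthT ≐ cn

digitwiseᶠ : QF 3 → QF 3 → QF 3
digitwiseᶠ whole blocks = t≤dᶠ ∧ᶠ ((t≡dᶠ ∧ᶠ whole) ∨ᶠ ((¬ᶠ t≡dᶠ) ∧ᶠ blocks))

ψ₀ ψ₁ : QF 3
ψ₀ = digitwiseᶠ (¬ᶠ (𝐚 ≐ 𝐛)) (halvesLeᶠ onesT xorT)
ψ₁ = digitwiseᶠ (𝐚 ≤ᶠ 𝐛) (halvesLeᶠ 𝐚 𝐛)

pM-exact : ∀ d {t} → t < nOf d → pM d t ≡ 2 ^ t
pM-exact d t<n = m≤n⇒m⊓n≡m (m<n⇒m≤n∸1 (^-monoʳ-< 2 (s≤s (s≤s z≤n)) t<n))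

sat-t≤d⇔ : ∀ d ρ → SatQF d ρ t≤dᶠ ⇔ arg₂ ρ ≤ d
sat-t≤d⇔ d ρ = mk⇔ sat⇒t≤d t≤d⇒sat
  where
  t = arg₂ ρ
  sat⇒t≤d : SatQF d ρ t≤dᶠ → t ≤ d
  sat⇒t≤d (t⊔n≢t , 2^t⊔n≡n) = 2^-cancel-≤ (subst (2 ^ t ≤_) 2^t⊔n≡n
    (subst (λ z → 2 ^ t ≤ z ⊔ nOf d) (sym (pM-exact d t<n)) (m≤m⊔n (2 ^ t) (nOf d))))
    where
    t<n : t < nOf d
    t<n with t <? nOf d
    ... | yes t<n = t<n
    ... | no t≮n = ⊥-elim (t⊔n≢t (m≥n⇒m⊔n≡m (≮⇒≥ t≮n)))
  t≤d⇒sat : t ≤ d → SatQF d ρ t≤dᶠ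
  t≤d⇒sat t≤d = (λ t⊔n≡t → <⇒≢ t<n (sym (trans (sym (m≤n⇒m⊔n≡n (<⇒≤ t<n))) t⊔n≡t))) ,
                trans (cong (_⊔ nOf d) (pM-exact d t<n)) (m≤n⇒m⊔n≡n (^-monoʳ-≤ 2 t≤d))
    where t<n : t < nOf d
          t<n = ≤-<-trans t≤d (n<2^n d)

sat-t≡d⇔ : ∀ d ρ → arg₂ ρ ≤ d → SatQF d ρ t≡dᶠ ⇔ arg₂ ρ ≡ d
sat-t≡d⇔ d ρ t≤d = mk⇔
  (λ 2^t≡n → ≤-antisym t≤d (2^-cancel-≤ (≤-reflexive (sym (trans (sym (pM-exact d t<n)) 2^t≡n)))))
  (λ { refl → pM-exact d t<n })
  where t<n : arg₂ ρ < nOf d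
        t<n = ≤-<-trans t≤d (n<2^n d)

module BlockCase (t s : ℕ) (ρ : Vector ℕ 3) (ρ₂≡t : arg₂ ρ ≡ t) where

  d : ℕ
  d = t + suc s

  L : ℕ
  L = 2 ^ s

  T≡2^t : suc (pred (2 ^ t)) ≡ 2 ^ t
  T≡2^t = suc-pred (2 ^ t) {{2^≢0 t}}

  n≡L*W : nOf d ≡ L * (suc (pred (2 ^ t)) + suc (pred (2 ^ t)))
  n≡L*W = begin
      2 ^ (t + suc s)        ≡⟨ ^-distribˡ-+-* 2 t (suc s) ⟩
      2 ^ t * (2 * 2 ^ s)    ≡⟨ regroup (2 ^ t) (2 ^ s) ⟩
      2 ^ s * (2 ^ t + 2 ^ t) ≡⟨ cong (λ z → 2 ^ s * (z + z)) T≡2^t ⟨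
      L * (suc (pred (2 ^ t)) + suc (pred (2 ^ t))) ∎
    where open ≡-Reasoning
          regroup : ∀ a b → a * (2 * b) ≡ b * (a + a)
          regroup = solve-∀

  open Blocks (pred (2 ^ t)) L (nOf d) n≡L*W public

  t<d : t < d
  t<d = m<m+n t (s≤s z≤n)

  C≤M : C ≤ M
  C≤M = subst (_≤ M) (*-identityʳ C) (subst (C ^ 1 ≤_) (sym M≡C^L) (^-monoʳ-≤ C (m^n>0 2 s)))

  B<M : B < M
  B<M = <-≤-trans B<C C≤M

  modT-size : ∀ z → modT z (size d) ≡ z % M
  modT-size z = modT≡% z M

  ⟦_⟧ : Term 3 → ℕ
  ⟦_⟧ = evalT d ρ

  mod-elim : ∀ {x y} → x ≡ y → y < M → modT x (size d) ≡ y
  mod-elim refl y<M = trans (modT-size _) (m<n⇒m%n≡m y<M)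

  eval-width : ⟦ widthT ⟧ ≡ T
  eval-width = trans (cong (pM d) ρ₂≡t) (trans (pM-exact d (<-trans t<d (n<2^n d))) (sym T≡2^t))

  eval-base : ⟦ baseT ⟧ ≡ B
  eval-base = trans (cong (pM d) eval-width) (m≤n⇒m⊓n≡m (m<n⇒m≤n∸1 B<M))

  eval-C∸1 : ⟦ ⟨+⟩ (⟨×⟩ baseT baseT) cm1 ⟧ ≡ C ∸ 1
  eval-C∸1 = begin
      modT (modT (⟦ baseT ⟧ * ⟦ baseT ⟧) (size d) + (M ∸ 1)) (size d)
    ≡⟨ cong (λ z → modT (modT (z * z) (size d) + (M ∸ 1)) (size d)) eval-base ⟩
      modT (modT (B * B) (size d) + (M ∸ 1)) (size d)
    ≡⟨ trans (modT-size _) (cong (λ z → (z + (M ∸ 1)) % M) (modT-size (B * B))) ⟩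
      ((B * B) % M + (M ∸ 1)) % M
    ≡⟨ [m%N+[N∸1]]%N≡m∸1 M (≤-trans (s≤s z≤n) (subst (2 ≤_) C≡B*B 2≤C)) (subst (_≤ M) C≡B*B C≤M) ⟩
      B * B ∸ 1
    ≡⟨ cong (_∸ 1) C≡B*B ⟨
      C ∸ 1
    ∎
    where open ≡-Reasoning

  eval-repunit : ⟦ repunitT ⟧ ≡ Q
  eval-repunit = trans (cong (divT (M ∸ 1)) eval-C∸1) (trans (divT≡/ (M ∸ 1) (C ∸ 1)) [M∸1]/[C∸1]≡Q)

  const<M : ∀ {k} → k < C → k * Q < M
  const<M {k} k<C = subst (_< M) (fromDigits-const C L k) (fromDigits<M _ (λ _ _ → k<C))

  eval-flags : ⟦ flagsT ⟧ ≡ flags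
  eval-flags = mod-elim (cong₂ _*_ eval-base eval-repunit) (const<M B<C)

  eval-B∸1 : ⟦ ⟨+⟩ baseT cm1 ⟧ ≡ B ∸ 1
  eval-B∸1 = trans (cong (λ z → modT (z + (M ∸ 1)) (size d)) eval-base)
    (trans (modT-size _) (trans (cong (λ z → (z + (M ∸ 1)) % M) (sym (m<n⇒m%n≡m B<M)))
      ([m%N+[N∸1]]%N≡m∸1 M (≤-trans (s≤s z≤n) 2≤B) (<⇒≤ B<M))))

  eval-lowMask : ⟦ lowMaskT ⟧ ≡ lowMask
  eval-lowMask = mod-elim (cong₂ _*_ eval-B∸1 eval-repunit) (const<M (<B⇒<C B∸1<B))

  eval-highMask : ⟦ highMaskT ⟧ ≡ highMask
  eval-highMask = mod-elim (cong₂ _*_ eval-base eval-lowMask)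
    (subst (_< M) (*-assoc B (B ∸ 1) Q) (const<M (subst (B * (B ∸ 1) <_) (sym C≡B*B) (*-monoʳ-< B B∸1<B))))

  eval-ones : ⟦ onesT ⟧ ≡ ones
  eval-ones = trans (cong₂ (λ u v → modT (u + v) (size d)) eval-repunit eval-flags) (modT-size _)

  eval-xor : ⟦ xorT ⟧ ≡ xorₘ ⟦ 𝐚 ⟧ ⟦ 𝐛 ⟧
  eval-xor = trans (modT-size _) (cong (λ z → (z + 1) % M) (trans (modT-size _)
               (cong₂ (λ u v → (u + negM d v) % M) (modT-size _) (modT-size _))))

  sat-blockwiseLe : ∀ u v → SatQF d ρ (blockwiseLeᶠ u v) ≡ BlockwiseLe ⟦ u ⟧ ⟦ v ⟧
  sat-blockwiseLe u v = cong₂ (λ w f → andBits (nOf d) w f ≡ f) eval-borrowTest eval-flags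
    where
    eval-borrowTest : ⟦ borrowTestT u v ⟧ ≡ borrowTest ⟦ u ⟧ ⟦ v ⟧
    eval-borrowTest = begin
        modT (modT (modT (⟦ v ⟧ + ⟦ flagsT ⟧) (size d) + negM d ⟦ u ⟧) (size d) + 1) (size d)
      ≡⟨ cong (λ z → modT (modT (modT (⟦ v ⟧ + z) (size d) + negM d ⟦ u ⟧) (size d) + 1) (size d)) eval-flags ⟩
        modT (modT (modT (⟦ v ⟧ + flags) (size d) + negM d ⟦ u ⟧) (size d) + 1) (size d)
      ≡⟨ trans (modT-size _) (cong (λ z → (z + 1) % M)
           (trans (modT-size _) (cong (λ z → (z + negM d ⟦ u ⟧) % M) (modT-size _)))) ⟩
        borrowTest ⟦ u ⟧ ⟦ v ⟧
      ∎
      where open ≡-Reasoning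

  sat-halvesLe : ∀ x y → SatQF d ρ (halvesLeᶠ x y) ≡ HalvesLe ⟦ x ⟧ ⟦ y ⟧
  sat-halvesLe x y = cong₂ _×_
    (trans (sat-blockwiseLe (lowHalvesT x) (lowHalvesT y)) (cong₂ BlockwiseLe (eval-lowHalves x) (eval-lowHalves y)))
    (trans (sat-blockwiseLe (highHalvesT x) (highHalvesT y)) (cong₂ BlockwiseLe (eval-highHalves x) (eval-highHalves y)))
    where
    eval-lowHalves : ∀ x → ⟦ lowHalvesT x ⟧ ≡ lowHalves ⟦ x ⟧
    eval-lowHalves x = cong (andBits (nOf d) ⟦ x ⟧) eval-lowMask
    eval-highHalves : ∀ x → ⟦ highHalvesT x ⟧ ≡ highHalves ⟦ x ⟧
    eval-highHalves x = trans (cong₂ divT (cong (andBits (nOf d) ⟦ x ⟧) eval-highMask) eval-base) (divT≡/ _ B)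

  digit≡digitᴮ : ∀ a k → digit a k t ≡ digitᴮ a k
  digit≡digitᴮ a k = trans (cong (λ z → modT (divT a (2 ^ (z * k))) (2 ^ z)) (sym T≡2^t))
                           (trans (modT≡% _ B) (cong (_% B) (divT≡/ a (2 ^ (T * k)) {{2^≢0 (T * k)}})))

  digits⇔digitsᴮ : ∀ (R : ℕ → ℕ → Set) a b →
    (∀ k → k < 2 ^ (d ∸ t) → R (digit a k t) (digit b k t)) ⇔ (∀ k → k < 2 * L → R (digitᴮ a k) (digitᴮ b k))
  digits⇔digitsᴮ R a b = mk⇔
    (λ h k k< → subst₂ R (digit≡digitᴮ a k) (digit≡digitᴮ b k) (h k (subst (k <_) (sym #digits≡) k<)))
    (λ h k k< → subst₂ R (sym (digit≡digitᴮ a k)) (sym (digit≡digitᴮ b k)) (h k (subst (k <_) #digits≡ k<)))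
    where #digits≡ : 2 ^ (d ∸ t) ≡ 2 * L
          #digits≡ = cong (2 ^_) (m+n∸m≡n t (suc s))

  a b : ℕ
  a = arg₀ ρ
  b = arg₁ ρ

  sat-blocks-≤ : a < M → b < M →
    SatQF d ρ (halvesLeᶠ 𝐚 𝐛) ⇔ (∀ k → k < 2 ^ (d ∸ t) → digit a k t ≤ digit b k t)
  sat-blocks-≤ a<M b<M = ⇔.trans (≡⇒⇔ (sat-halvesLe 𝐚 𝐛))
    (⇔.trans (halvesLe⇔digits≤ a<M b<M) (⇔.sym (digits⇔digitsᴮ _≤_ a b)))

  sat-blocks-≢ : a < M → b < M →
    SatQF d ρ (halvesLeᶠ onesT xorT) ⇔ (∀ k → k < 2 ^ (d ∸ t) → digit a k t ≢ digit b k t)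
  sat-blocks-≢ a<M b<M = ⇔.trans (≡⇒⇔ (trans (sat-halvesLe onesT xorT) (cong₂ HalvesLe eval-ones eval-xor)))
    (⇔.trans (halvesLe-ones-xor⇔digits≢ a<M b<M) (⇔.sym (digits⇔digitsᴮ _≢_ a b)))

digit-whole : ∀ {a} d → a < size d → digit a 0 d ≡ a
digit-whole {a} d a<M = begin
    modT (divT a (2 ^ (2 ^ d * 0))) (size d)  ≡⟨ cong (λ z → modT (divT a (2 ^ z)) (size d)) (*-zeroʳ (2 ^ d)) ⟩
    modT (divT a 1) (size d)                  ≡⟨ cong (λ z → modT z (size d)) (n/1≡n a) ⟩
    modT a (size d)                           ≡⟨ modT≡% a (size d) {{2^≢0 (2 ^ d)}} ⟩
    a %2^ nOf d                               ≡⟨ m<n⇒m%n≡m {{2^≢0 (2 ^ d)}} a<M ⟩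
    a                                         ∎
  where open ≡-Reasoning

digits-whole⇔ : ∀ (R : ℕ → ℕ → Set) d {a b} → a < size d → b < size d →
  (∀ k → k < 2 ^ (d ∸ d) → R (digit a k d) (digit b k d)) ⇔ R a b
digits-whole⇔ R d {a} {b} a<M b<M = mk⇔
  (λ h → subst₂ R (digit-whole d a<M) (digit-whole d b<M) (h 0 (subst (0 <_) (sym #digits≡1) (s≤s z≤n))))
  (λ r k k< → case-k≡0 k (subst (k <_) #digits≡1 k<) r)
  where
  #digits≡1 : 2 ^ (d ∸ d) ≡ 1
  #digits≡1 = cong (2 ^_) (n∸n≡0 d)
  case-k≡0 : ∀ k → k < 1 → R a b → R (digit a k d) (digit b k d)
  case-k≡0 zero _ r = subst₂ R (sym (digit-whole d a<M)) (sym (digit-whole d b<M)) r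
  case-k≡0 (suc k) (s≤s ()) r

m<n⇒m+[1+k]≡n : ∀ {m n} → m < n → ∃[ k ] m + suc k ≡ n
m<n⇒m+[1+k]≡n {m} {n} m<n = n ∸ suc m , trans (+-suc m (n ∸ suc m)) (m+[n∸m]≡n m<n)

sat-digitwise-whole⇔ : ∀ d ρ {whole blocks} → arg₂ ρ ≡ d →
  SatQF d ρ (digitwiseᶠ whole blocks) ⇔ SatQF d ρ whole
sat-digitwise-whole⇔ d ρ t≡d = mk⇔
  (λ { (_ , inj₁ (_ , sat)) → sat ; (_ , inj₂ (t≢d , _)) → ⊥-elim (t≢d t≡d-holds) })
  (λ sat → Equivalence.from (sat-t≤d⇔ d ρ) t≤d , inj₁ (t≡d-holds , sat))
  where
  t≤d = ≤-reflexive t≡d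
  t≡d-holds = Equivalence.from (sat-t≡d⇔ d ρ t≤d) t≡d

sat-digitwise-blocks⇔ : ∀ d ρ {whole blocks} → arg₂ ρ < d →
  SatQF d ρ (digitwiseᶠ whole blocks) ⇔ SatQF d ρ blocks
sat-digitwise-blocks⇔ d ρ t<d = mk⇔
  (λ { (_ , inj₁ (t≡d , _)) → ⊥-elim (t≢d t≡d) ; (_ , inj₂ (_ , sat)) → sat })
  (λ sat → Equivalence.from (sat-t≤d⇔ d ρ) (<⇒≤ t<d) , inj₂ (t≢d , sat))
  where
  t≢d : ¬ SatQF d ρ t≡dᶠ
  t≢d sat = <⇒≢ t<d (Equivalence.to (sat-t≡d⇔ d ρ (<⇒≤ t<d)) sat)

Digitwise : (ℕ → ℕ → Set) → ℕ → ℕ → ℕ → ℕ → Set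
Digitwise R d a b t = t ≤ d × (∀ k → k < 2 ^ (d ∸ t) → R (digit a k t) (digit b k t))

digitwise⇔digits : ∀ {R d a b t} → t ≤ d → Digitwise R d a b t ⇔ (∀ k → k < 2 ^ (d ∸ t) → R (digit a k t) (digit b k t))
digitwise⇔digits t≤d = mk⇔ proj₂ (t≤d ,_)

digitwise⇔ : ∀ (R : ℕ → ℕ → Set) (whole blocks : QF 3) →
  (∀ d ρ → SatQF d ρ whole ⇔ R (arg₀ ρ) (arg₁ ρ)) →
  (∀ t s ρ → arg₂ ρ ≡ t → arg₀ ρ < size (t + suc s) → arg₁ ρ < size (t + suc s) →
     SatQF (t + suc s) ρ blocks ⇔ (∀ k → k < 2 ^ (t + suc s ∸ t) → R (digit (arg₀ ρ) k t) (digit (arg₁ ρ) k t))) →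
  ∀ d ρ → arg₀ ρ < size d → arg₁ ρ < size d →
  Digitwise R d (arg₀ ρ) (arg₁ ρ) (arg₂ ρ) ⇔ SatQF d ρ (digitwiseᶠ whole blocks)
digitwise⇔ R whole blocks whole⇔ blocks⇔ d ρ a<M b<M with arg₂ ρ ≤? d
... | no t≰d = mk⇔ (λ (t≤d , _) → ⊥-elim (t≰d t≤d))
                   (λ (t≤d , _) → ⊥-elim (t≰d (Equivalence.to (sat-t≤d⇔ d ρ) t≤d)))
... | yes t≤d with m≤n⇒m<n∨m≡n t≤d
...   | inj₂ refl = ⇔.trans (digitwise⇔digits {R} t≤d) (⇔.trans (digits-whole⇔ R d a<M b<M)
                      (⇔.sym (⇔.trans (sat-digitwise-whole⇔ d ρ refl) (whole⇔ d ρ))))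
...   | inj₁ t<d with m<n⇒m+[1+k]≡n t<d
...     | s , refl = ⇔.trans (digitwise⇔digits {R} t≤d)
                      (⇔.sym (⇔.trans (sat-digitwise-blocks⇔ d ρ t<d) (blocks⇔ _ s ρ refl a<M b<M)))

m⊔n≡n⇔m≤n : ∀ {m n} → m ⊔ n ≡ n ⇔ m ≤ n
m⊔n≡n⇔m≤n {m} {n} = mk⇔ (λ m⊔n≡n → subst (m ≤_) m⊔n≡n (m≤m⊔n m n)) m≤n⇒m⊔n≡n

ternary : (ℕ → ℕ → ℕ → ℕ → Set) → Family 3
ternary R d v = R d (arg₀ v) (arg₁ v) (arg₂ v)

quantifierFree⇒uniformlyExistential : ∀ (R : ℕ → ℕ → ℕ → ℕ → Set) (ψ : QF 3) →
  (∀ d ρ → arg₀ ρ < size d → arg₁ ρ < size d → ternary R d ρ ⇔ SatQF d ρ ψ) →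
  UniformlyExistential (ternary R)
quantifierFree⇒uniformlyExistential R ψ R⇔ψ = ∃ᶠ 0 ψ , λ d v v<M → mk⇔
  (λ r → (λ ()) , (λ ()) , Equivalence.to (R⇔ψ d (v ++ λ ()) (v<M F.zero) (v<M (F.suc F.zero))) r)
  (λ (w , _ , sat) → Equivalence.from (R⇔ψ d (v ++ w) (v<M F.zero) (v<M (F.suc F.zero))) sat)

lemma26 : UniformlyExistential R0 × UniformlyExistential R1
lemma26 =
  quantifierFree⇒uniformlyExistential R0rel ψ₀
    (digitwise⇔ _≢_ (¬ᶠ (𝐚 ≐ 𝐛)) (halvesLeᶠ onesT xorT) (λ _ _ → ⇔.refl) BlockCase.sat-blocks-≢) ,
  quantifierFree⇒uniformlyExistential R1rel ψ₁
    (digitwise⇔ _≤_ (𝐚 ≤ᶠ 𝐛) (halvesLeᶠ 𝐚 𝐛) (λ _ _ → m⊔n≡n⇔m≤n) BlockCase.sat-blocks-≤)
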